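{- Let $K_n$ be the complete graph of order $n$ and $k$ a positive integer. Then $d_R^k(K_n)=n$ if $n\ge 2k$; $d_R^k(K_n)\le 2k-1$ if $n\le 2k-1$; and $d_R^k(K_n)=2k-1$ if $k\ge 2$ and $2k-2\le n\le 2k-1$.
   Context: Let $k\ge1$ be an integer. A Roman $k$-dominating function (RkDF) on a graph $G$ is a map $f:V(G)\to\{0,1,2\}$ such that every vertex $v$ with $f(v)=0$ has at least $k$ neighbors $u$ with $f(u)=2$. A set $\{f_1,\ldots,f_d\}$ of pairwise distinct RkDFs on $G$ with $\sum_{i=1}^d f_i(v)\le 2k$ for every $v\in V(G)$ is a Roman $(k,k)$-dominating family on $G$; the maximum number of functions in such a family is the Roman $(k,k)$-domatic number $d_R^k(G)$. -}

module Defs where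

open import Data.Nat using (ℕ; _+_; _≤_; _≥_; _∸_; _*_)
import Data.Nat
open import Data.Fin using (Fin; toℕ)
open import Data.Fin.Properties using (_≟_)
open import Data.Bool using (Bool; true; false; _∧_; not)
open import Data.List using (List; length; filterᵇ; map)
open import Data.Nat.ListAction using (sum)
open import Data.List using () renaming (allFin to allFinL)
open import Data.Product using (Σ; _×_)
open import Relation.Nullary using (¬_; Dec; yes; no)
open import Relation.Nullary.Decidable using (⌊_⌋)
open import Relation.Binary.PropositionalEquality using (_≡_; _≢_)

record Graph : Set where
  field
    order : ℕ
    adj   : Fin order → Fin order → Bool
open Graph public

K : ℕ → Graph
K n = record { order = n ; adj = λ u v → not ⌊ u ≟ v ⌋ }

-- Values {0,1,2} represented by Fin 3; toℕ gives the numeric value.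
Label : Set
Label = Fin 3

VFun : Graph → Set
VFun G = Fin (order G) → Label

count2 : (G : Graph) → VFun G → Fin (order G) → ℕ
count2 G f v =
  length (filterᵇ (λ u → adj G v u ∧ ⌊ toℕ (f u) Data.Nat.≟ 2 ⌋) (allFinL (order G)))

IsRkDF : ℕ → (G : Graph) → VFun G → Set
IsRkDF k G f = (v : Fin (order G)) → toℕ (f v) ≡ 0 → k ≤ count2 G f v

sumAt : {G : Graph} {d : ℕ} → (Fin d → VFun G) → Fin (order G) → ℕ
sumAt {d = d} F v = sum (map (λ i → toℕ (F i v)) (allFinL d))

IsRkkFamily : ℕ → (G : Graph) → (d : ℕ) → (Fin d → VFun G) → Set
IsRkkFamily k G d F =
  ((i : Fin d) → IsRkDF k G (F i))
  × ((i j : Fin d) → i ≢ j → ¬ ((v : Fin (order G)) → F i v ≡ F j v))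
  × ((v : Fin (order G)) → sumAt {G} F v ≤ 2 * k)

IsRkDomaticNumber : ℕ → Graph → ℕ → Set
IsRkDomaticNumber k G d =
  Σ (Fin d → VFun G) (IsRkkFamily k G d)
  × ((d' : ℕ) (F : Fin d' → VFun G) → IsRkkFamily k G d' F → d' ≤ d)

module Submission where

-- Weights: an RkDF f on K_n with a vertex labelled 0 carries ≥ k labels 2 (that
-- vertex sees every other one), so w(f) = Σ_v f(v) ≥ 2k; summing Σ_i f_i(v) ≤ 2k
-- over the vertices gives Σ_i w(f_i) ≤ 2kn.  Hence d ≤ n when n ≥ 2k, and when
-- n < 2k every member except (at most once) the constant function 1 has weight
-- ≥ n + 1, so d(n+1) ≤ 2kn + 1 forces d < 2k.
-- Constructions: for n ≥ 2k the n cyclic windows f_i(v) = 2·[(i+v) mod n < k]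
-- are a family; for d ≤ n + 1 and d < 2k the "pointed" functions (constant 1,
-- except a single 2 at vertex i-1 for i ≥ 1) are one.
-- Existence: families of a fixed size can be searched exhaustively, so bounded
-- family sizes have a maximum.

open import Defs
open import Data.Nat using (ℕ; _+_; _≤_; _≥_; _∸_; _*_)
open import Data.Product using (Σ; _×_)
open import Data.Nat as ℕ
  using (zero; suc; _<_; _^_; _<ᵇ_; _≡ᵇ_; _%_; NonZero; z≤n; s≤s; >-nonZero; s<s⁻¹)
open import Data.Nat.Properties
open import Data.Nat.DivMod using (_mod_; [m+n]%n≡m%n; m<n⇒m%n≡m; %-distribˡ-+; m%n%n≡m%n; n%n≡0)
open import Data.Nat.ListAction using (sum)
open import Data.Fin using (Fin; toℕ; fromℕ; fromℕ<; inject₁; finToFun; funToFin)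
  renaming (zero to fzero; suc to fsuc)
open import Data.Fin.Properties
  using (toℕ-injective; toℕ<n; toℕ-fromℕ; toℕ-fromℕ<; toℕ-inject₁; any?; all?; ¬∀⟶∃¬; finToFun-funToFin)
  renaming (_≟_ to _≟ᶠ_; 0≢1+n to fzero≢fsuc; suc-injective to fsuc-injective)
open import Data.Bool using (Bool; true; false; T; _∧_; not)
open import Data.List using (length; filterᵇ; map; tabulate)
open import Data.Product using (_,_; ∃)
open import Data.Sum using (_⊎_; inj₁; inj₂)
open import Data.Empty using (⊥; ⊥-elim)
open import Data.Unit using (tt)
open import Function using (_∘_; id)
open import Relation.Nullary using (¬_; Dec; yes; no; contradiction)
open import Relation.Nullary.Decidable using (⌊_⌋; isYes; map′; _×-dec_; _→-dec_; ¬?; toWitness; decidable-stable)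
open import Relation.Binary.PropositionalEquality
  using (_≡_; _≢_; refl; sym; trans; cong; cong₂; subst; module ≡-Reasoning)
open import Relation.Binary.Definitions using (tri<; tri≈; tri>)
open import Algebra.Properties.Semiring.Sum +-*-semiring
  using (sum-syntax; sum-cong-≗; sum-init-last; ∑-distrib-+; ∑-comm; *-distribˡ-sum)

[_] : Bool → ℕ
[ true ]  = 1
[ false ] = 0

∑-mono : ∀ {n} {g h : Fin n → ℕ} → (∀ i → g i ≤ h i) → ∑[ i < n ] g i ≤ ∑[ i < n ] h i
∑-mono {zero}  _  = z≤n
∑-mono {suc n} le = +-mono-≤ (le fzero) (∑-mono (le ∘ fsuc))

∑-const : ∀ n c → ∑[ i < n ] c ≡ n * c
∑-const zero    c = refl
∑-const (suc n) c = cong (c +_) (∑-const n c)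

∑-positive : ∀ {n} (g : Fin n → ℕ) → (∀ i → 1 ≤ g i) → n ≤ ∑[ i < n ] g i
∑-positive {zero}  g pos = z≤n
∑-positive {suc n} g pos = +-mono-≤ (pos fzero) (∑-positive (g ∘ fsuc) (pos ∘ fsuc))

∑-strict : ∀ {n} (g : Fin n → ℕ) → (∀ i → 1 ≤ g i) → (w : Fin n) → 2 ≤ g w →
           suc n ≤ ∑[ i < n ] g i
∑-strict g pos fzero     two = +-mono-≤ two (∑-positive (g ∘ fsuc) (pos ∘ fsuc))
∑-strict g pos (fsuc w) two = +-mono-≤ (pos fzero) (∑-strict (g ∘ fsuc) (pos ∘ fsuc) w two)

∑-none : ∀ {n} (p : Fin n → Bool) → (∀ i → ¬ T (p i)) → ∑[ i < n ] [ p i ] ≡ 0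
∑-none {zero}  p none = refl
∑-none {suc n} p none with p fzero | none fzero
... | false | _   = ∑-none (p ∘ fsuc) (none ∘ fsuc)
... | true  | ¬tt = ⊥-elim (¬tt tt)

∑-atMostOne : ∀ {n} (p : Fin n → Bool) → (∀ i j → T (p i) → T (p j) → i ≡ j) →
              ∑[ i < n ] [ p i ] ≤ 1
∑-atMostOne {zero}  p unique = z≤n
∑-atMostOne {suc n} p unique with p fzero in p0
... | false = ∑-atMostOne (p ∘ fsuc) (λ i j pi pj → fsuc-injective (unique (fsuc i) (fsuc j) pi pj))
... | true  = ≤-reflexive (cong suc (∑-none (p ∘ fsuc) (λ i pi → fzero≢fsuc (unique fzero (fsuc i) holds pi))))
  where
  holds : T (p fzero)
  holds = subst T (sym p0) tt

∑-below : ∀ {n k} → k ≤ n → ∑[ v < n ] [ toℕ v <ᵇ k ] ≡ k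
∑-below {n}     {zero}  _         = ∑-none {n} (λ v → toℕ v <ᵇ 0) (λ _ ())
∑-below {suc n} {suc k} (s≤s k≤n) = cong suc (∑-below k≤n)

∑-periodic-shift : ∀ n (g : ℕ → ℕ) → (∀ c → g (c + n) ≡ g c) →
                   ∀ s → ∑[ v < n ] g (s + toℕ v) ≡ ∑[ v < n ] g (toℕ v)
∑-periodic-shift n g periodic zero    = refl
∑-periodic-shift n g periodic (suc s) = trans (shift-by-one n refl) (∑-periodic-shift n g periodic s)
  where
  open ≡-Reasoning
  -- peel the last term off the left window and the first term off the right one
  shift-by-one : ∀ m → m ≡ n → ∑[ v < m ] g (suc s + toℕ v) ≡ ∑[ v < m ] g (s + toℕ v)
  shift-by-one zero    _    = refl
  shift-by-one (suc m) refl = begin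
      ∑[ v < suc m ] g (suc s + toℕ v)
    ≡⟨ sum-init-last (λ v → g (suc s + toℕ v)) ⟩
      ∑[ v < m ] g (suc s + toℕ (inject₁ v)) + g (suc s + toℕ (fromℕ m))
    ≡⟨ cong₂ _+_ (sum-cong-≗ {m} (λ v → cong g (trans (cong (suc s +_) (toℕ-inject₁ v)) (sym (+-suc s (toℕ v))))))
                 (trans (cong g (trans (cong (suc s +_) (toℕ-fromℕ m)) (sym (+-suc s m)))) (periodic s)) ⟩
      ∑[ v < m ] g (s + suc (toℕ v)) + g s
    ≡⟨ +-comm _ (g s) ⟩
      g s + ∑[ v < m ] g (s + suc (toℕ v))
    ≡⟨ cong (λ x → g x + ∑[ v < m ] g (s + suc (toℕ v))) (sym (+-identityʳ s)) ⟩
      ∑[ v < suc m ] g (s + toℕ v) ∎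

sum-map-tabulate : ∀ {A : Set} {n} (g : Fin n → A) (h : A → ℕ) →
                   sum (map h (tabulate g)) ≡ ∑[ i < n ] h (g i)
sum-map-tabulate {n = zero}  g h = refl
sum-map-tabulate {n = suc n} g h = cong (h (g fzero) +_) (sum-map-tabulate (g ∘ fsuc) h)

length-filter-tabulate : ∀ {A : Set} {n} (g : Fin n → A) (p : A → Bool) →
                         length (filterᵇ p (tabulate g)) ≡ ∑[ i < n ] [ p (g i) ]
length-filter-tabulate {n = zero}  g p = refl
length-filter-tabulate {n = suc n} g p with p (g fzero)
... | true  = cong suc (length-filter-tabulate (g ∘ fsuc) p)
... | false = length-filter-tabulate (g ∘ fsuc) p

isTwo : Label → Bool
isTwo x = ⌊ toℕ x ℕ.≟ 2 ⌋

count2-∑ : ∀ G (f : VFun G) v → count2 G f v ≡ ∑[ u < order G ] [ adj G v u ∧ isTwo (f u) ]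
count2-∑ G f v = length-filter-tabulate id (λ u → adj G v u ∧ isTwo (f u))

sumAt-∑ : ∀ {G d} (F : Fin d → VFun G) v → sumAt {G} F v ≡ ∑[ i < d ] toℕ (F i v)
sumAt-∑ F v = sum-map-tabulate id (λ i → toℕ (F i v))

weight : (G : Graph) → VFun G → ℕ
weight G f = ∑[ v < order G ] toℕ (f v)

twos : (G : Graph) → VFun G → ℕ
twos G f = ∑[ v < order G ] [ isTwo (f v) ]

twos≤weight : ∀ G (f : VFun G) → 2 * twos G f ≤ weight G f
twos≤weight G f = begin
    2 * twos G f                           ≡⟨ *-distribˡ-sum 2 (λ v → [ isTwo (f v) ]) ⟩
    ∑[ v < order G ] (2 * [ isTwo (f v) ]) ≤⟨ ∑-mono (λ v → label (f v)) ⟩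
    weight G f                             ∎
  where
  open ≤-Reasoning
  label : ∀ x → 2 * [ isTwo x ] ≤ toℕ x
  label fzero               = z≤n
  label (fsuc fzero)        = z≤n
  label (fsuc (fsuc fzero)) = ≤-refl

count2≤twos : ∀ G (f : VFun G) v → count2 G f v ≤ twos G f
count2≤twos G f v = ≤-trans (≤-reflexive (count2-∑ G f v)) (∑-mono (λ u → ∧-bound (adj G v u) _))
  where
  ∧-bound : ∀ a b → [ a ∧ b ] ≤ [ b ]
  ∧-bound true  b = ≤-refl
  ∧-bound false b = z≤n

count2-complete : ∀ {n} (f : VFun (K n)) v → toℕ (f v) ≡ 0 → count2 (K n) f v ≡ twos (K n) f
count2-complete {n} f v zero-at-v = trans (count2-∑ (K n) f v) (sum-cong-≗ same)
  where
  same : ∀ u → [ not ⌊ v ≟ᶠ u ⌋ ∧ isTwo (f u) ] ≡ [ isTwo (f u) ]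
  same u with v ≟ᶠ u
  ... | yes refl rewrite zero-at-v = refl
  ... | no _     = refl

-- On K_n an RkDF takes no value 0, or it carries k labels 2 and so has weight ≥ 2k.
rkdf-weight : ∀ {n k} (f : VFun (K n)) → IsRkDF k (K n) f →
              (∀ v → 1 ≤ toℕ (f v)) ⊎ 2 * k ≤ weight (K n) f
rkdf-weight {n} {k} f rkdf with any? (λ v → toℕ (f v) ℕ.≟ 0)
... | yes (v , zero-at-v) = inj₂ (begin
        2 * k                 ≤⟨ *-monoʳ-≤ 2 (rkdf v zero-at-v) ⟩
        2 * count2 (K n) f v  ≡⟨ cong (2 *_) (count2-complete f v zero-at-v) ⟩
        2 * twos (K n) f      ≤⟨ twos≤weight (K n) f ⟩
        weight (K n) f        ∎)
  where open ≤-Reasoning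
... | no no-zero = inj₁ (λ v → n≢0⇒n>0 (λ zero-at-v → no-zero (v , zero-at-v)))

-- Summing Σ_i f_i(v) ≤ 2k over the vertices bounds the total weight of a family.
family-weight : ∀ {k G d} (F : Fin d → VFun G) → IsRkkFamily k G d F →
                ∑[ i < d ] weight G (F i) ≤ order G * (2 * k)
family-weight {k} {G} {d} F (_ , _ , bounded) = begin
    ∑[ i < d ] ∑[ v < order G ] toℕ (F i v)  ≡⟨ ∑-comm (λ i v → toℕ (F i v)) ⟩
    ∑[ v < order G ] ∑[ i < d ] toℕ (F i v)  ≤⟨ ∑-mono (λ v → ≤-trans (≤-reflexive (sym (sumAt-∑ {G} F v))) (bounded v)) ⟩
    ∑[ v < order G ] (2 * k)                 ≡⟨ ∑-const (order G) (2 * k) ⟩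
    order G * (2 * k)                        ∎
  where open ≤-Reasoning

-- Upper bound for n ≥ 2k: every member has weight ≥ 2k, so d·2k ≤ n·2k.
family-bound-large : ∀ {n k d} (F : Fin d → VFun (K n)) → 1 ≤ k → 2 * k ≤ n →
                     IsRkkFamily k (K n) d F → d ≤ n
family-bound-large {n} {k@(suc _)} {d} F _ large family@(rkdf , _ , _) =
  *-cancelʳ-≤ d n (2 * k) (begin
    d * (2 * k)                 ≡⟨ sym (∑-const d (2 * k)) ⟩
    ∑[ i < d ] (2 * k)          ≤⟨ ∑-mono heavy ⟩
    ∑[ i < d ] weight (K n) (F i) ≤⟨ family-weight F family ⟩
    n * (2 * k)                 ∎)
  where
  open ≤-Reasoning
  heavy : ∀ i → 2 * k ≤ weight (K n) (F i)
  heavy i with rkdf-weight (F i) (rkdf i)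
  ... | inj₁ positive = ≤-trans large (∑-positive _ positive)
  ... | inj₂ heavy-i  = heavy-i

allOnes? : ∀ {G} (f : VFun G) → Dec (∀ v → toℕ (f v) ≡ 1)
allOnes? f = all? (λ v → toℕ (f v) ℕ.≟ 1)

weight-unless-allOnes : ∀ {n k} (f : VFun (K n)) → suc n ≤ 2 * k → IsRkDF k (K n) f →
                        (ones? : Dec (∀ v → toℕ (f v) ≡ 1)) →
                        suc n ≤ weight (K n) f + [ isYes ones? ]
weight-unless-allOnes {n} f _ _ (yes ones) =
  ≤-trans (≤-reflexive (+-comm 1 n)) (+-monoˡ-≤ 1 (∑-positive _ (λ v → ≤-reflexive (sym (ones v)))))
weight-unless-allOnes {n} f small rkdf (no not-ones)
  with rkdf-weight f rkdf | ¬∀⟶∃¬ n _ (λ v → toℕ (f v) ℕ.≟ 1) not-ones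
... | inj₂ heavy    | _             = ≤-trans small (≤-trans heavy (m≤m+n _ 0))
... | inj₁ positive | (w , not-one) =
  ≤-trans (∑-strict _ positive w (above-one (f w) (positive w) not-one)) (m≤m+n _ 0)
  where
  above-one : ∀ (x : Label) → 1 ≤ toℕ x → toℕ x ≢ 1 → 2 ≤ toℕ x
  above-one (fsuc fzero)        _ not-one = contradiction refl not-one
  above-one (fsuc (fsuc fzero)) _ _       = ≤-refl

-- Upper bound for n < 2k: distinct members include the constant function 1 at
-- most once, so d(n+1) ≤ Σ_i (w(f_i) + [f_i ≡ 1]) ≤ 2kn + 1, which rules out d ≥ 2k.
family-bound-small : ∀ {n k d} (F : Fin d → VFun (K n)) → 1 ≤ k → suc n ≤ 2 * k →
                     IsRkkFamily k (K n) d F → d < 2 * k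
family-bound-small {n} {k} {d} F k≥1 small family@(rkdf , distinct , _) =
  decidable-stable (d ℕ.<? 2 * k) (λ d≮2k → contradiction (2k≤1 (≮⇒≥ d≮2k)) (<⇒≱ 2≤2k))
  where
  open ≤-Reasoning
  ones? : ∀ i → Dec (∀ v → toℕ (F i v) ≡ 1)
  ones? i = all? (λ v → toℕ (F i v) ℕ.≟ 1)

  -- two members equal to the constant function 1 would coincide
  one-constant-member : ∑[ i < d ] [ isYes (ones? i) ] ≤ 1
  one-constant-member = ∑-atMostOne (λ i → isYes (ones? i)) unique
    where
    unique : ∀ i j → T (isYes (ones? i)) → T (isYes (ones? j)) → i ≡ j
    unique i j ones-i ones-j with i ≟ᶠ j
    ... | yes i≡j = i≡j
    ... | no  i≢j = contradiction
          (λ v → toℕ-injective (trans (toWitness ones-i v) (sym (toWitness ones-j v))))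
          (distinct i j i≢j)

  2≤2k : 2 ≤ 2 * k
  2≤2k = *-monoʳ-≤ 2 k≥1

  -- 2k(n+1) ≤ d(n+1) ≤ 2kn + 1 when d ≥ 2k
  2k≤1 : 2 * k ≤ d → 2 * k ≤ 1
  2k≤1 many = +-cancelʳ-≤ (2 * k * n) (2 * k) 1 (begin
      2 * k + 2 * k * n                              ≡⟨ sym (*-suc (2 * k) n) ⟩
      2 * k * suc n                                  ≤⟨ *-monoˡ-≤ (suc n) many ⟩
      d * suc n                                      ≡⟨ sym (∑-const d (suc n)) ⟩
      ∑[ i < d ] suc n                               ≤⟨ ∑-mono (λ i → weight-unless-allOnes (F i) small (rkdf i) (ones? i)) ⟩
      ∑[ i < d ] (weight (K n) (F i) + [ isYes (ones? i) ])
                                                     ≡⟨ ∑-distrib-+ (λ i → weight (K n) (F i)) (λ i → [ isYes (ones? i) ]) ⟩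
      ∑[ i < d ] weight (K n) (F i) + ∑[ i < d ] [ isYes (ones? i) ]
                                                     ≤⟨ +-mono-≤ (family-weight F family) one-constant-member ⟩
      n * (2 * k) + 1                                ≡⟨ cong (_+ 1) (*-comm n (2 * k)) ⟩
      2 * k * n + 1                                  ≡⟨ +-comm (2 * k * n) 1 ⟩
      1 + 2 * k * n                                  ∎)

oneOrTwo : Bool → Label
oneOrTwo false = fsuc fzero
oneOrTwo true  = fsuc (fsuc fzero)

oneOrTwo-injective : ∀ {a b} → oneOrTwo a ≡ oneOrTwo b → a ≡ b
oneOrTwo-injective {false} {false} _ = refl
oneOrTwo-injective {true}  {true}  _ = refl

toℕ-oneOrTwo : ∀ b → toℕ (oneOrTwo b) ≡ 1 + [ b ]
toℕ-oneOrTwo false = refl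
toℕ-oneOrTwo true  = refl

-- The pointed functions on a graph of order n: p_i(v) = 2 if v + 1 = i, else 1.
-- p_0 is the constant function 1 and p_i (i ≥ 1) has its only 2 at vertex i - 1.
pointed : (G : Graph) (d : ℕ) → Fin d → VFun G
pointed G d i v = oneOrTwo (suc (toℕ v) ≡ᵇ toℕ i)

pointed-separates : ∀ G d (i j : Fin d) s → suc s ≡ toℕ i → (s<n : s < order G) → i ≢ j →
                    ¬ (∀ v → pointed G d i v ≡ pointed G d j v)
pointed-separates G d i j s i≡s+1 s<n i≢j same =
  j-misses (subst T (oneOrTwo-injective (same vertex)) i-hits)
  where
  vertex : Fin (order G)
  vertex = fromℕ< s<n
  at-vertex : suc (toℕ vertex) ≡ toℕ i
  at-vertex = trans (cong suc (toℕ-fromℕ< s<n)) i≡s+1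
  i-hits : T (suc (toℕ vertex) ≡ᵇ toℕ i)
  i-hits = ≡⇒≡ᵇ _ _ at-vertex
  j-misses : ¬ T (suc (toℕ vertex) ≡ᵇ toℕ j)
  j-misses hit = i≢j (toℕ-injective (trans (sym at-vertex) (≡ᵇ⇒≡ _ _ hit)))

-- For d ≤ n + 1 and d + 1 ≤ 2k the pointed functions form an R(k,k)-family on any
-- graph of order n: they never take the value 0, each vertex carries at most one 2.
pointed-family : ∀ {k} G d → d ≤ suc (order G) → suc d ≤ 2 * k →
                 IsRkkFamily k G d (pointed G d)
pointed-family {k} G d few fits = no-zeros , distinct , bounded
  where
  open ≤-Reasoning
  no-zeros : ∀ i → IsRkDF k G (pointed G d i)
  no-zeros i v is-zero with suc (toℕ v) ≡ᵇ toℕ i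
  no-zeros i v () | false
  no-zeros i v () | true

  vertex-below : ∀ (i : Fin d) s → suc s ≡ toℕ i → s < order G
  vertex-below i s i≡s+1 = s<s⁻¹ (≤-trans (subst (_< d) (sym i≡s+1) (toℕ<n i)) few)

  -- one of two distinct indices is positive and so points at a vertex
  distinct : ∀ i j → i ≢ j → ¬ (∀ v → pointed G d i v ≡ pointed G d j v)
  distinct i j i≢j same = by-cases (toℕ i) (toℕ j) refl refl
    where
    by-cases : ∀ a b → toℕ i ≡ a → toℕ j ≡ b → ⊥
    by-cases (suc s) _       ei _  = pointed-separates G d i j s (sym ei) (vertex-below i s (sym ei)) i≢j same
    by-cases zero    (suc s) _  ej = pointed-separates G d j i s (sym ej) (vertex-below j s (sym ej))
                                       (i≢j ∘ sym) (λ v → sym (same v))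
    by-cases zero    zero    ei ej = i≢j (toℕ-injective (trans ei (sym ej)))

  bounded : ∀ v → sumAt {G} (pointed G d) v ≤ 2 * k
  bounded v = begin
      sumAt {G} (pointed G d) v                     ≡⟨ sumAt-∑ {G} (pointed G d) v ⟩
      ∑[ i < d ] toℕ (pointed G d i v)              ≡⟨ sum-cong-≗ {d} (λ i → toℕ-oneOrTwo (suc (toℕ v) ≡ᵇ toℕ i)) ⟩
      ∑[ i < d ] (1 + [ suc (toℕ v) ≡ᵇ toℕ i ])     ≡⟨ ∑-distrib-+ {d} (λ _ → 1) (λ i → [ suc (toℕ v) ≡ᵇ toℕ i ]) ⟩
      ∑[ i < d ] 1 + ∑[ i < d ] [ suc (toℕ v) ≡ᵇ toℕ i ]
                                                    ≤⟨ +-mono-≤ (≤-reflexive (trans (∑-const d 1) (*-identityʳ d)))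
                                                                (∑-atMostOne {d} (λ i → suc (toℕ v) ≡ᵇ toℕ i) one-hit) ⟩
      d + 1                                         ≡⟨ +-comm d 1 ⟩
      suc d                                         ≤⟨ fits ⟩
      2 * k                                         ∎
    where
    one-hit : ∀ (i j : Fin d) → T (suc (toℕ v) ≡ᵇ toℕ i) → T (suc (toℕ v) ≡ᵇ toℕ j) → i ≡ j
    one-hit i j hit-i hit-j =
      toℕ-injective (trans (sym (≡ᵇ⇒≡ (suc (toℕ v)) (toℕ i) hit-i)) (≡ᵇ⇒≡ (suc (toℕ v)) (toℕ j) hit-j))

twoOrZero : Bool → Label
twoOrZero false = fzero
twoOrZero true  = fsuc (fsuc fzero)

twoOrZero-injective : ∀ {a b} → twoOrZero a ≡ twoOrZero b → a ≡ b
twoOrZero-injective {false} {false} _ = refl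
twoOrZero-injective {true}  {true}  _ = refl

toℕ-twoOrZero : ∀ b → toℕ (twoOrZero b) ≡ 2 * [ b ]
toℕ-twoOrZero false = refl
toℕ-twoOrZero true  = refl

isTwo-twoOrZero : ∀ b → [ isTwo (twoOrZero b) ] ≡ [ b ]
isTwo-twoOrZero false = refl
isTwo-twoOrZero true  = refl

module Cyclic (n k : ℕ) .{{_ : NonZero n}} where

  inWindow : ℕ → Bool
  inWindow c = c % n <ᵇ k

  window : Fin n → VFun (K n)
  window i v = twoOrZero (inWindow (toℕ i + toℕ v))

  window-size : k ≤ n → ∀ s → ∑[ v < n ] [ inWindow (s + toℕ v) ] ≡ k
  window-size k≤n s = begin
      ∑[ v < n ] [ inWindow (s + toℕ v) ]  ≡⟨ ∑-periodic-shift n (λ c → [ inWindow c ]) periodic s ⟩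
      ∑[ v < n ] [ inWindow (toℕ v) ]      ≡⟨ sum-cong-≗ {n} (λ v → cong (λ r → [ r <ᵇ k ]) (m<n⇒m%n≡m (toℕ<n v))) ⟩
      ∑[ v < n ] [ toℕ v <ᵇ k ]            ≡⟨ ∑-below k≤n ⟩
      k                                    ∎
    where
    open ≡-Reasoning
    periodic : ∀ c → [ inWindow (c + n) ] ≡ [ inWindow c ]
    periodic c = cong (λ r → [ r <ᵇ k ]) ([m+n]%n≡m%n c n)

  -- A vertex labelled 0 by w_i sees all k labels 2 of w_i.
  window-rkdf : k ≤ n → ∀ i → IsRkDF k (K n) (window i)
  window-rkdf k≤n i v zero-at-v = ≤-reflexive (sym (begin
      count2 (K n) (window i) v                ≡⟨ count2-complete (window i) v zero-at-v ⟩
      twos (K n) (window i)                    ≡⟨ sum-cong-≗ {n} (λ u → isTwo-twoOrZero (inWindow (toℕ i + toℕ u))) ⟩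
      ∑[ u < n ] [ inWindow (toℕ i + toℕ u) ]  ≡⟨ window-size k≤n (toℕ i) ⟩
      k                                        ∎))
    where open ≡-Reasoning

  -- Each vertex v lies in exactly k windows, so it receives total label 2k.
  window-load : k ≤ n → ∀ v → sumAt {K n} window v ≤ 2 * k
  window-load k≤n v = ≤-reflexive (begin
      sumAt {K n} window v                          ≡⟨ sumAt-∑ {K n} window v ⟩
      ∑[ i < n ] toℕ (window i v)                   ≡⟨ sum-cong-≗ {n} label ⟩
      ∑[ i < n ] (2 * [ inWindow (toℕ v + toℕ i) ]) ≡⟨ sym (*-distribˡ-sum {n} 2 (λ i → [ inWindow (toℕ v + toℕ i) ])) ⟩
      2 * ∑[ i < n ] [ inWindow (toℕ v + toℕ i) ]   ≡⟨ cong (2 *_) (window-size k≤n (toℕ v)) ⟩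
      2 * k                                         ∎)
    where
    open ≡-Reasoning
    label : ∀ i → toℕ (window i v) ≡ 2 * [ inWindow (toℕ v + toℕ i) ]
    label i = trans (toℕ-twoOrZero _) (cong (λ c → 2 * [ inWindow c ]) (+-comm (toℕ i) (toℕ v)))

  -- The vertex at which the window w_i starts: i + opposite i ≡ 0 (mod n).
  opposite : Fin n → Fin n
  opposite i = (n ∸ toℕ i) mod n

  at-opposite : ∀ i b → (b + toℕ (opposite i)) % n ≡ (b + (n ∸ toℕ i)) % n
  at-opposite i b = begin
      (b + toℕ (opposite i)) % n       ≡⟨ cong (λ x → (b + x) % n) (toℕ-fromℕ< _) ⟩
      (b + m % n) % n                  ≡⟨ %-distribˡ-+ b (m % n) n ⟩
      (b % n + m % n % n) % n          ≡⟨ cong (λ x → (b % n + x) % n) (m%n%n≡m%n m n) ⟩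
      (b % n + m % n) % n              ≡⟨ sym (%-distribˡ-+ b m n) ⟩
      (b + m) % n                      ∎
    where
    open ≡-Reasoning
    m = n ∸ toℕ i

  offset-self : ∀ a → a ≤ n → (a + (n ∸ a)) % n ≡ 0
  offset-self a a≤n = trans (cong (_% n) (m+[n∸m]≡n a≤n)) (n%n≡0 n)

  offsets-sum : ∀ {a b} → a < b → b < n → (b + (n ∸ a)) % n + (a + (n ∸ b)) % n ≡ n
  offsets-sum {a} {b} a<b b<n = begin
      (b + (n ∸ a)) % n + (a + (n ∸ b)) % n  ≡⟨ cong₂ _+_ forward (m<n⇒m%n≡m backward<n) ⟩
      (b ∸ a) + (a + (n ∸ b))                ≡⟨ sym (+-assoc (b ∸ a) a (n ∸ b)) ⟩
      (b ∸ a + a) + (n ∸ b)                  ≡⟨ cong (_+ (n ∸ b)) (m∸n+n≡m a≤b) ⟩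
      b + (n ∸ b)                            ≡⟨ m+[n∸m]≡n b≤n ⟩
      n                                      ∎
    where
    open ≡-Reasoning
    a≤b = <⇒≤ a<b
    b≤n = <⇒≤ b<n
    -- b + (n - a) = (b - a) + n, and b - a < n
    forward : (b + (n ∸ a)) % n ≡ b ∸ a
    forward = begin
        (b + (n ∸ a)) % n        ≡⟨ cong (λ x → (x + (n ∸ a)) % n) (sym (m∸n+n≡m a≤b)) ⟩
        (b ∸ a + a + (n ∸ a)) % n ≡⟨ cong (_% n) (+-assoc (b ∸ a) a (n ∸ a)) ⟩
        (b ∸ a + (a + (n ∸ a))) % n ≡⟨ cong (λ x → (b ∸ a + x) % n) (m+[n∸m]≡n (≤-trans a≤b b≤n)) ⟩
        (b ∸ a + n) % n          ≡⟨ [m+n]%n≡m%n (b ∸ a) n ⟩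
        (b ∸ a) % n              ≡⟨ m<n⇒m%n≡m (≤-<-trans (m∸n≤m b a) b<n) ⟩
        b ∸ a                    ∎
    backward<n : a + (n ∸ b) < n
    backward<n = subst (a + (n ∸ b) <_) (m+[n∸m]≡n b≤n) (+-monoˡ-< (n ∸ b) a<b)

  -- If w_i = w_j, then w_j also contains the start of w_i.
  shared-start : 1 ≤ k → ∀ i j → (∀ v → window i v ≡ window j v) → (toℕ j + (n ∸ toℕ i)) % n < k
  shared-start k≥1 i j same = subst (_< k) (at-opposite i (toℕ j)) (<ᵇ⇒< _ k j-hits)
    where
    start : (toℕ i + toℕ (opposite i)) % n ≡ 0
    start = trans (at-opposite i (toℕ i)) (offset-self (toℕ i) (<⇒≤ (toℕ<n i)))
    i-hits : T (inWindow (toℕ i + toℕ (opposite i)))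
    i-hits = subst (λ r → T (r <ᵇ k)) (sym start) (<⇒<ᵇ k≥1)
    j-hits : T (inWindow (toℕ j + toℕ (opposite i)))
    j-hits = subst T (twoOrZero-injective (same (opposite i))) i-hits

  -- Distinct windows differ: equal windows would force both offsets below k,
  -- although they add up to n ≥ 2k.
  windows-differ : 1 ≤ k → 2 * k ≤ n → ∀ i j → toℕ i < toℕ j → ¬ (∀ v → window i v ≡ window j v)
  windows-differ k≥1 large i j i<j same = <⇒≱ (begin-strict
      n                                                      ≡⟨ sym (offsets-sum i<j (toℕ<n j)) ⟩
      (toℕ j + (n ∸ toℕ i)) % n + (toℕ i + (n ∸ toℕ j)) % n  <⟨ +-mono-< (shared-start k≥1 i j same)
                                                                  (shared-start k≥1 j i (λ v → sym (same v))) ⟩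
      k + k                                                  ≡⟨ cong (k +_) (sym (+-identityʳ k)) ⟩
      2 * k                                                  ∎) large
    where open ≤-Reasoning

  windows-distinct : 1 ≤ k → 2 * k ≤ n → ∀ i j → i ≢ j → ¬ (∀ v → window i v ≡ window j v)
  windows-distinct k≥1 large i j i≢j same with <-cmp (toℕ i) (toℕ j)
  ... | tri< i<j _ _ = windows-differ k≥1 large i j i<j same
  ... | tri≈ _ i≡j _ = i≢j (toℕ-injective i≡j)
  ... | tri> _ _ j<i = windows-differ k≥1 large j i j<i (λ v → sym (same v))

  window-family : 1 ≤ k → 2 * k ≤ n → IsRkkFamily k (K n) n window
  window-family k≥1 large =
    window-rkdf k≤n , windows-distinct k≥1 large , window-load k≤n
    where
    k≤n : k ≤ n
    k≤n = ≤-trans (m≤m+n k (k + 0)) large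

-- Exhaustive search over families: a family Fin d → Fin n → Fin m is coded by an
-- element of the finite set Fin ((m ^ n) ^ d).
decodeFamily : ∀ {d n m} → Fin ((m ^ n) ^ d) → Fin d → Fin n → Fin m
decodeFamily c i = finToFun (finToFun c i)

encodeFamily : ∀ {d n m} → (Fin d → Fin n → Fin m) → Fin ((m ^ n) ^ d)
encodeFamily F = funToFin (λ i → funToFin (F i))

decode-encode : ∀ {d n m} (F : Fin d → Fin n → Fin m) i v → decodeFamily (encodeFamily F) i v ≡ F i v
decode-encode F i v =
  trans (cong (λ c → finToFun c v) (finToFun-funToFin (λ i → funToFin (F i)) i)) (finToFun-funToFin (F i) v)

any-family? : ∀ {d n m} {P : (Fin d → Fin n → Fin m) → Set} →
              (∀ {F F′} → (∀ i v → F i v ≡ F′ i v) → P F → P F′) → (∀ F → Dec (P F)) → Dec (∃ P)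
any-family? respects P? =
  map′ (λ (c , p) → decodeFamily c , p)
       (λ (F , p) → encodeFamily F , respects (λ i v → sym (decode-encode F i v)) p)
       (any? (P? ∘ decodeFamily))

family-respects : ∀ {k G d} {F F′ : Fin d → VFun G} → (∀ i v → F i v ≡ F′ i v) →
                  IsRkkFamily k G d F → IsRkkFamily k G d F′
family-respects {k} {G} {d} {F} {F′} F≗F′ (rkdf , distinct , bounded) =
  (λ i v zero-at-v → ≤-trans (rkdf i v (trans (cong toℕ (F≗F′ i v)) zero-at-v)) (≤-reflexive (count2-same i v))) ,
  (λ i j i≢j same → distinct i j i≢j (λ v → trans (F≗F′ i v) (trans (same v) (sym (F≗F′ j v))))) ,
  (λ v → ≤-trans (≤-reflexive (sumAt-same v)) (bounded v))
  where
  count2-same : ∀ i v → count2 G (F i) v ≡ count2 G (F′ i) v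
  count2-same i v = trans (count2-∑ G (F i) v)
    (trans (sum-cong-≗ {order G} (λ u → cong (λ x → [ adj G v u ∧ isTwo x ]) (F≗F′ i u))) (sym (count2-∑ G (F′ i) v)))
  sumAt-same : ∀ v → sumAt {G} F′ v ≡ sumAt {G} F v
  sumAt-same v = trans (sumAt-∑ {G} F′ v)
    (trans (sum-cong-≗ {d} (λ i → cong toℕ (sym (F≗F′ i v)))) (sym (sumAt-∑ {G} F v)))

family? : ∀ k G d (F : Fin d → VFun G) → Dec (IsRkkFamily k G d F)
family? k G d F =
  all? (λ i → all? (λ v → (toℕ (F i v) ℕ.≟ 0) →-dec (k ℕ.≤? count2 G (F i) v))) ×-dec
  (all? (λ i → all? (λ j → ¬? (i ≟ᶠ j) →-dec ¬? (all? (λ v → F i v ≟ᶠ F j v)))) ×-dec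
   all? (λ v → sumAt {G} F v ℕ.≤? 2 * k))

greatest : (P : ℕ → Set) → (∀ d → Dec (P d)) → ∀ {d₀} → P d₀ → ∀ B → (∀ d → P d → d ≤ B) →
           Σ ℕ (λ d → P d × (∀ d′ → P d′ → d′ ≤ d))
greatest P P? p₀ B bounded with P? B
... | yes p = B , p , bounded
greatest P P? {d₀} p₀ zero    bounded | no ¬p with bounded d₀ p₀
... | z≤n = contradiction p₀ ¬p
greatest P P? p₀ (suc B) bounded | no ¬p = greatest P P? p₀ B below
  where
  below : ∀ d → P d → d ≤ B
  below d p with m≤n⇒m<n∨m≡n (bounded d p)
  ... | inj₁ d<1+B = ≤-pred d<1+B
  ... | inj₂ refl  = contradiction p ¬p

-- If family sizes on G are bounded by B, the Roman (k,k)-domatic number of G exists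
-- (the empty family is always admissible).
domatic-number-exists : ∀ k G B → (∀ d F → IsRkkFamily k G d F → d ≤ B) →
                        Σ ℕ (λ d → IsRkDomaticNumber k G d × d ≤ B)
domatic-number-exists k G B bounded
  with greatest (λ d → Σ (Fin d → VFun G) (IsRkkFamily k G d))
                (λ d → any-family? (family-respects {k} {G} {d}) (family? k G d))
                {0} ((λ ()) , (λ ()) , (λ ()) , (λ _ → z≤n))
                B (λ d (F , family) → bounded d F family)
... | d , (F , family) , maximal =
  d , ((F , family) , (λ d′ F′ family′ → maximal d′ (F′ , family′))) , bounded d F family

theorem3 : (n k : ℕ) → 1 ≤ k →
      (n ≥ 2 * k → IsRkDomaticNumber k (K n) n)
    × (n ≤ 2 * k ∸ 1 → Σ ℕ (λ d → IsRkDomaticNumber k (K n) d × d ≤ 2 * k ∸ 1))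
    × (k ≥ 2 → 2 * k ∸ 2 ≤ n → n ≤ 2 * k ∸ 1 → IsRkDomaticNumber k (K n) (2 * k ∸ 1))
theorem3 n k k≥1 = large , small , critical
  where
  2k>0 : 0 < 2 * k
  2k>0 = ≤-trans k≥1 (m≤m+n k (k + 0))

  below-2k : ∀ {m} → m ≤ 2 * k ∸ 1 → m < 2 * k
  below-2k m≤ = ≤-trans (s≤s m≤) (≤-reflexive (suc-pred (2 * k) {{>-nonZero 2k>0}}))

  bound-small : n ≤ 2 * k ∸ 1 → ∀ d F → IsRkkFamily k (K n) d F → d ≤ 2 * k ∸ 1
  bound-small n<2k d F family = <⇒≤pred (family-bound-small F k≥1 (below-2k n<2k) family)

  large : n ≥ 2 * k → IsRkDomaticNumber k (K n) n
  large n≥2k = (window , window-family k≥1 n≥2k) , (λ d F family → family-bound-large F k≥1 n≥2k family)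
    where open Cyclic n k {{>-nonZero (≤-trans 2k>0 n≥2k)}}

  small : n ≤ 2 * k ∸ 1 → Σ ℕ (λ d → IsRkDomaticNumber k (K n) d × d ≤ 2 * k ∸ 1)
  small n<2k = domatic-number-exists k (K n) (2 * k ∸ 1) (bound-small n<2k)

  critical : k ≥ 2 → 2 * k ∸ 2 ≤ n → n ≤ 2 * k ∸ 1 → IsRkDomaticNumber k (K n) (2 * k ∸ 1)
  critical _ n≥2k-2 n<2k =
    (pointed (K n) (2 * k ∸ 1) , pointed-family (K n) (2 * k ∸ 1) few fits) , bound-small n<2k
    where
    few : 2 * k ∸ 1 ≤ suc n
    few = ≤-trans (m≤n+m∸n (2 * k ∸ 1) 1)
                  (≤-trans (≤-reflexive (cong suc (∸-+-assoc (2 * k) 1 1))) (s≤s n≥2k-2))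
    fits : suc (2 * k ∸ 1) ≤ 2 * k
    fits = below-2k ≤-refl
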